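{- Let $U=(P,\mathcal{B})$ be a unital of order $n\ge 2$ with incidence graph $G$ on vertex set $V=P\cup\mathcal{B}$. Let $S\subseteq V$ with $1\le |S|\le |V|/2$, let $X=S\cap P$, $Y=S\cap\mathcal{B}$, and set $x=|X|$, $y=|Y|$, $x'=|N(Y)\setminus X|$, $y'=|N(X)\setminus Y|$. Let $c(n) = n^2 - \frac{\sqrt{8n^2+9}-3}{2}$ and \[ f(x,y) = \frac{4x}{(n+1)^2}(n^3+1) + \left(1 - \frac{4x}{(n+1)^2}\right)\frac{n^2(n+1)y}{n^2(n-1)+y} - x. \] If either \[ x \le \frac{(n+1)^2}{4} \quad\text{and}\quad \frac{f(x,y)}{x+y} \ge \frac{2(n^3+1-\lfloor c(n)\rfloor)}{n^4+n^2}, \] or \[ x > \frac{(n+1)^2}{4} \quad\text{and}\quad x - \left(1-\frac{(n+1)^2}{4x}\right)y' < \lfloor c(n)\rfloor+1, \] then \[ \frac{x'+y'}{x+y} \ge \frac{2(n^3+1-\lfloor c(n)\rfloor)}{n^2(n^2 + 1)}. \]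
   Context: A unital of order $n\ge 2$ is a $2$-$(n^3+1,n+1,1)$ design $(P,\mathcal{B})$: $P$ is a set of $n^3+1$ points, $\mathcal{B}$ a set of $(n+1)$-subsets (lines) such that every two points lie on exactly one line (so each point lies on $n^2$ lines and there are $n^4-n^3+n^2$ lines). The incidence graph $G$ is the bipartite graph on $P\cup\mathcal{B}$ with $p\sim B$ iff $p\in B$. For a set $T$ of vertices, $N(T)$ is the set of vertices outside $T$ adjacent to some vertex of $T$. -}

module Defs where

open import Data.Nat as ℕ using (ℕ; zero; suc; _^_)
open import Data.Integer as ℤ using (ℤ; +_)
open import Data.Rational as ℚ using (ℚ; _/_; 0ℚ)
open import Data.Fin using (Fin)
open import Data.Fin.Subset using (Subset; _∈_; _─_; ∣_∣)
open import Data.Fin.Subset.Properties using (_∈?_)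
open import Data.Fin.Properties using (any?)
open import Data.Vec using (tabulate)
open import Data.Product using (Σ; _×_; _,_)
open import Data.Sum using (_⊎_)
open import Relation.Nullary using (¬_; does)
open import Relation.Nullary.Decidable using (_×-dec_)
open import Relation.Binary.PropositionalEquality using (_≡_)

-- A unital of order n: a 2-(n^3+1, n+1, 1) design.
-- Points are Fin (n^3+1); the (distinct) blocks/lines are indexed by Fin nLines.
record Unital (n : ℕ) : Set where
  field
    nLines   : ℕ
    line     : Fin nLines → Subset (suc (n ^ 3))
    distinct : ∀ b c → line b ≡ line c → b ≡ c
    lineSize : ∀ b → ∣ line b ∣ ≡ suc n
    twoPts   : ∀ p q → ¬ (p ≡ q) →
               Σ (Fin nLines) λ b → (p ∈ line b × q ∈ line b) ×
                 (∀ c → p ∈ line c → q ∈ line c → c ≡ b)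

module _ {n : ℕ} (U : Unital n) where
  open Unital U

  nbrPts : Subset nLines → Subset (suc (n ^ 3))
  nbrPts Y = tabulate λ p → does (any? λ b → (b ∈? Y) ×-dec (p ∈? line b))

  nbrLines : Subset (suc (n ^ 3)) → Subset nLines
  nbrLines X = tabulate λ b → does (any? λ p → (p ∈? X) ×-dec (p ∈? line b))

  x′ : Subset (suc (n ^ 3)) → Subset nLines → ℕ
  x′ X Y = ∣ nbrPts Y ─ X ∣

  y′ : Subset (suc (n ^ 3)) → Subset nLines → ℕ
  y′ X Y = ∣ nbrLines X ─ Y ∣

-- Rational embeddings and division by a natural number
-- (convention q ÷ℕ 0 = 0; only ever used with positive denominators).
ℕ→ℚ : ℕ → ℚ
ℕ→ℚ k = + k / 1

ℤ→ℚ : ℤ → ℚ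
ℤ→ℚ k = k / 1

_÷ℕ_ : ℚ → ℕ → ℚ
q ÷ℕ zero  = 0ℚ
q ÷ℕ suc d = q ℚ.* (+ 1 / suc d)

_√≤_ : ℕ → ℤ → Set
D √≤ t = (+ 0 ℤ.≤ t) × (+ D ℤ.≤ t ℤ.* t)

_<√_ : ℤ → ℕ → Set
t <√ D = (t ℤ.< + 0) ⊎ (t ℤ.* t ℤ.< + D)

-- k = ⌊c(n)⌋ where c(n) = n² - (√(8n²+9) - 3)/2, characterised by k ≤ c(n) < k+1:
--   k ≤ c(n)    ⇔  √(8n²+9) ≤ 2n² + 3 - 2k
--   c(n) < k+1  ⇔  2n² + 1 - 2k < √(8n²+9)
IsFloorC : ℕ → ℤ → Set
IsFloorC n k =
  ((8 ℕ.* n ^ 2 ℕ.+ 9) √≤ (+ (2 ℕ.* n ^ 2) ℤ.+ + 3 ℤ.- + 2 ℤ.* k)) ×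
  ((+ (2 ℕ.* n ^ 2) ℤ.+ + 1 ℤ.- + 2 ℤ.* k) <√ (8 ℕ.* n ^ 2 ℕ.+ 9))

fFun : ℕ → ℕ → ℕ → ℚ
fFun n x y =
  let a = ℕ→ℚ (4 ℕ.* x) ÷ℕ ((n ℕ.+ 1) ^ 2) in
  a ℚ.* ℕ→ℚ (n ^ 3 ℕ.+ 1)
  ℚ.+ (ℚ.1ℚ ℚ.- a) ℚ.* (ℕ→ℚ (n ^ 2 ℕ.* (n ℕ.+ 1) ℕ.* y) ÷ℕ (n ^ 2 ℕ.* (n ℕ.∸ 1) ℕ.+ y))
  ℚ.- ℕ→ℚ x

module Submission where

-- Lemma 3.1: expansion of the incidence graph of a unital of order n ≥ 2.
-- Write x = |X|, y = |Y|, x' = |N(Y) ∖ X|, y' = |N(X) ∖ Y| and z for the number of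
-- far points, those outside X ∪ N(Y); then x + x' + z = n³ + 1.  Two counting facts
-- about unitals drive the proof:
--   (A) 4·x·z ≤ y'·(n+1)²: each pair in X × far is joined by a line of N(X) ∖ Y, and
--       a line meeting X in a points and the far set in c ≤ n + 1 - a points carries
--       ac ≤ (n+1)²/4 such pairs;
--   (B) n²(n+1)·y ≤ |N(Y)|·(n²(n-1) + y): Cauchy–Schwarz over the lines outside Y,
--       applied to the number of points off N(Y) on each line.
-- Both rest on the parameters of a unital: every point is on n² lines and there are
-- n⁴ - n³ + n² lines.  If x ≤ (n+1)²/4, (A) and (B) give f(x, y) ≤ x' + y'; otherwise
-- (A) and the hypothesis give n³ + 1 - k ≤ x' + y', and |S| ≤ |V|/2 with |V| odd gives
-- 2(x + y) ≤ n²(n² + 1).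

open import Defs
open import Data.Nat as ℕ using (ℕ; _^_)
open import Data.Integer as ℤ using (ℤ; +_)
open import Data.Rational as ℚ using (ℚ)
open import Data.Fin.Subset using (Subset; ∣_∣)
open import Data.Product using (_×_)
open import Data.Sum using (_⊎_)

open import Data.Nat using (zero; suc; _+_; _*_; _∸_; _≤_; _<_; z≤n; s≤s)
import Data.Nat.Properties as ℕP
open import Data.Nat.Tactic.RingSolver using (solve-∀)
open import Data.Bool using (Bool; true; false; not; _∧_; _∨_)
open import Data.Bool.Properties using (∧-zeroʳ; ∧-identityʳ)
open import Data.Fin using (Fin; zero; suc)
open import Data.Fin.Properties using (any?) renaming (_≟_ to _≟ᶠ_)
open import Data.Fin.Subset using (_─_)
open import Data.Fin.Subset.Properties using (_∈?_)
open import Data.Vec using ([]; _∷_; lookup)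
open import Data.Vec.Properties using (lookup∘tabulate; []=⇒lookup; lookup⇒[]=)
open import Data.Product using (Σ; _,_; uncurry)
open import Data.Sum using (inj₁; inj₂; [_,_]′)
open import Data.Empty using (⊥-elim)
open import Function using (_∘_)
open import Relation.Nullary using (yes; no; does)
open import Relation.Nullary.Decidable using (_×-dec_; dec-true)
open import Relation.Binary.PropositionalEquality
import Data.Integer.Properties as ℤP
import Data.Rational.Properties as ℚP
open import Data.Rational using (_/_; 0ℚ; 1ℚ)
open import Data.Rational.Unnormalised as ℚᵘ using (mkℚᵘ; *≡*; *≤*; *<*)
import Data.Rational.Unnormalised.Properties as ℚᵘP
open import Data.Rational.Solver using (module +-*-Solver)
open import Algebra.Properties.Semiring.Sum ℕP.+-*-semiring
  using (sum; sum-syntax; ∑-distrib-+; ∑-comm; *-distribˡ-sum; *-distribʳ-sum; sum-cong-≗)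

-- The ring solver does not accept _^_, so
-- the polynomial identities below write powers out as products (n ^ 2 is
-- definitionally n * (n * 1)).

∑-const : ∀ m c → ∑[ i < m ] c ≡ m * c
∑-const zero    c = refl
∑-const (suc m) c = cong (_+_ c) (∑-const m c)

∑-mono-≤ : ∀ {m} {f g : Fin m → ℕ} → (∀ i → f i ≤ g i) → sum f ≤ sum g
∑-mono-≤ {zero}  f≤g = z≤n
∑-mono-≤ {suc m} f≤g = ℕP.+-mono-≤ (f≤g zero) (∑-mono-≤ (f≤g ∘ suc))

∑-zero : ∀ {m} {f : Fin m → ℕ} → (∀ i → f i ≡ 0) → sum f ≡ 0
∑-zero {m} f≡0 = trans (sum-cong-≗ f≡0) (trans (∑-const m 0) (ℕP.*-zeroʳ m))

∑-product : ∀ {m k} (u : Fin m → ℕ) (v : Fin k → ℕ) →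
            sum u * sum v ≡ ∑[ i < m ] ∑[ j < k ] (u i * v j)
∑-product u v = trans (*-distribʳ-sum (sum v) u) (sum-cong-≗ λ i → *-distribˡ-sum (u i) v)

δ : ∀ {m} → Fin m → Fin m → ℕ
δ zero    zero    = 1
δ zero    (suc _) = 0
δ (suc _) zero    = 0
δ (suc i) (suc j) = δ i j

δ-refl : ∀ {m} (i : Fin m) → δ i i ≡ 1
δ-refl zero    = refl
δ-refl (suc i) = δ-refl i

δ-≢ : ∀ {m} {i j : Fin m} → i ≢ j → δ i j ≡ 0
δ-≢ {i = zero}  {zero}  i≢j = ⊥-elim (i≢j refl)
δ-≢ {i = zero}  {suc j} i≢j = refl
δ-≢ {i = suc i} {zero}  i≢j = refl
δ-≢ {i = suc i} {suc j} i≢j = δ-≢ (i≢j ∘ cong suc)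

∑-δ : ∀ {m} (p : Fin m) (c : Fin m → ℕ) → ∑[ q < m ] (δ p q * c q) ≡ c p
∑-δ {suc m} zero    c = begin
  1 * c zero + ∑[ q < m ] 0 ≡⟨ cong₂ _+_ (ℕP.*-identityˡ (c zero)) (trans (∑-const m 0) (ℕP.*-zeroʳ m)) ⟩
  c zero + 0                ≡⟨ ℕP.+-identityʳ (c zero) ⟩
  c zero                    ∎
  where open ≡-Reasoning
∑-δ {suc m} (suc p) c = ∑-δ p (c ∘ suc)

∑-single : ∀ {m} (g : Fin m → ℕ) (b : Fin m) → g b ≡ 1 → (∀ c → c ≢ b → g c ≡ 0) → sum g ≡ 1
∑-single g b gb≡1 g≡0 = trans (sum-cong-≗ g≡δ) (∑-δ b (λ _ → 1))
  where
  g≡δ : ∀ c → g c ≡ δ b c * 1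
  g≡δ c with c ≟ᶠ b
  ... | yes refl = trans gb≡1 (cong (_* 1) (sym (δ-refl c)))
  ... | no c≢b   = trans (g≡0 c c≢b) (cong (_* 1) (sym (δ-≢ (c≢b ∘ sym))))

2ab≤a²+b²-ordered : ∀ {a b} → a ≤ b → 2 * (a * b) ≤ a * a + b * b
2ab≤a²+b²-ordered {a} a≤b with ℕP.m≤n⇒∃[o]m+o≡n a≤b
... | d , refl = ℕP.≤-trans (ℕP.m≤m+n _ (d * d)) (ℕP.≤-reflexive (square a d))
  where
  square : ∀ a d → 2 * (a * (a + d)) + d * d ≡ a * a + (a + d) * (a + d)
  square = solve-∀

2ab≤a²+b² : ∀ a b → 2 * (a * b) ≤ a * a + b * b
2ab≤a²+b² a b with ℕP.≤-total a b
... | inj₁ a≤b = 2ab≤a²+b²-ordered a≤b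
... | inj₂ b≤a = subst₂ _≤_ (cong (2 *_) (ℕP.*-comm b a)) (ℕP.+-comm (b * b) (a * a))
                   (2ab≤a²+b²-ordered b≤a)

4ab≤c² : ∀ {a b c} → a + b ≤ c → 4 * (a * b) ≤ c * c
4ab≤c² {a} {b} {c} a+b≤c = begin
  4 * (a * b)                       ≡⟨ split a b ⟩
  2 * (a * b) + 2 * (a * b)         ≤⟨ ℕP.+-monoˡ-≤ (2 * (a * b)) (2ab≤a²+b² a b) ⟩
  a * a + b * b + 2 * (a * b)       ≡⟨ binomial a b ⟩
  (a + b) * (a + b)                 ≤⟨ ℕP.*-mono-≤ a+b≤c a+b≤c ⟩
  c * c                             ∎
  where
  open ℕP.≤-Reasoning
  split : ∀ a b → 4 * (a * b) ≡ 2 * (a * b) + 2 * (a * b)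
  split = solve-∀
  binomial : ∀ a b → a * a + b * b + 2 * (a * b) ≡ (a + b) * (a + b)
  binomial = solve-∀

-- The Cauchy–Schwarz inequality (∑ fᵢgᵢ)² ≤ (∑ fᵢ²)(∑ gᵢ²) over ℕ, proved by
-- summing 2(fᵢgⱼ)(fⱼgᵢ) ≤ (fᵢgⱼ)² + (fⱼgᵢ)² over all pairs (i, j).
cauchy-schwarz : ∀ {m} (f g : Fin m → ℕ) →
  sum (λ i → f i * g i) * sum (λ i → f i * g i) ≤ sum (λ i → f i * f i) * sum (λ i → g i * g i)
cauchy-schwarz {m} f g = ℕP.*-cancelˡ-≤ 2 (begin
  2 * (sum fg * sum fg)                       ≡⟨ cong (2 *_) (∑-product fg fg) ⟩
  2 * ∑[ i < m ] ∑[ j < m ] (fg i * fg j)     ≡⟨ double ⟩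
  ∑[ i < m ] ∑[ j < m ] (2 * (fg i * fg j))   ≤⟨ ∑-mono-≤ (λ i → ∑-mono-≤ (λ j → pairwise i j)) ⟩
  ∑[ i < m ] ∑[ j < m ] (P i j + P j i)       ≡⟨ symmetrise ⟩
  2 * (sum ff * sum gg)                       ∎)
  where
  open ℕP.≤-Reasoning
  fg ff gg : Fin m → ℕ
  fg i = f i * g i
  ff i = f i * f i
  gg i = g i * g i
  P : Fin m → Fin m → ℕ
  P i j = ff i * gg j

  double : 2 * ∑[ i < m ] ∑[ j < m ] (fg i * fg j) ≡ ∑[ i < m ] ∑[ j < m ] (2 * (fg i * fg j))
  double = trans (*-distribˡ-sum 2 (λ i → ∑[ j < m ] (fg i * fg j)))
                 (sum-cong-≗ λ i → *-distribˡ-sum 2 (λ j → fg i * fg j))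

  rearrange : ∀ a b c d → 2 * ((a * b) * (c * d)) ≡ 2 * ((a * d) * (c * b))
  rearrange = solve-∀
  square : ∀ a b → (a * b) * (a * b) ≡ (a * a) * (b * b)
  square = solve-∀

  pairwise : ∀ i j → 2 * (fg i * fg j) ≤ P i j + P j i
  pairwise i j = subst₂ _≤_ (sym (rearrange (f i) (g i) (f j) (g j)))
                   (cong₂ _+_ (square (f i) (g j)) (square (f j) (g i)))
                   (2ab≤a²+b² (f i * g j) (f j * g i))

  symmetrise : ∑[ i < m ] ∑[ j < m ] (P i j + P j i) ≡ 2 * (sum ff * sum gg)
  symmetrise = begin-equality
    ∑[ i < m ] ∑[ j < m ] (P i j + P j i)
      ≡⟨ sum-cong-≗ (λ i → ∑-distrib-+ (P i) (λ j → P j i)) ⟩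
    ∑[ i < m ] (∑[ j < m ] P i j + ∑[ j < m ] P j i)
      ≡⟨ ∑-distrib-+ (λ i → ∑[ j < m ] P i j) (λ i → ∑[ j < m ] P j i) ⟩
    ∑[ i < m ] ∑[ j < m ] P i j + ∑[ i < m ] ∑[ j < m ] P j i
      ≡⟨ cong (_+_ (∑[ i < m ] ∑[ j < m ] P i j)) (∑-comm (λ i j → P j i)) ⟩
    ∑[ i < m ] ∑[ j < m ] P i j + ∑[ i < m ] ∑[ j < m ] P i j
      ≡⟨ cong (λ s → s + s) (sym (∑-product ff gg)) ⟩
    sum ff * sum gg + sum ff * sum gg
      ≡⟨ cong (_+_ (sum ff * sum gg)) (sym (ℕP.+-identityʳ (sum ff * sum gg))) ⟩
    2 * (sum ff * sum gg) ∎

linearised-cs : ∀ {a D M T} z → 1 ≤ a → a * a ≡ D + M → T + z ≡ z * z + z * a →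
                (z * a) * (z * a) ≤ M * T → z * D + M ≤ M * a
linearised-cs {a} {M = M} zero 1≤a _ _ _ = ℕP.m≤m*n M a {{ℕ.>-nonZero 1≤a}}
linearised-cs {a} {D} {M} {T} (suc z-1) 1≤a a²≡D+M T+z cs =
  ℕP.+-cancelʳ-≤ (M * z) (z * D + M) (M * a) (begin
    z * D + M + M * z     ≡⟨ expand-D z D M ⟩
    z * (D + M) + M       ≡⟨ cong (λ s → z * s + M) (sym a²≡D+M) ⟩
    z * (a * a) + M       ≤⟨ ℕP.*-cancelˡ-≤ z (subst₂ _≤_ (factor-lhs z a M) (factor-rhs z a M) scaled) ⟩
    M * z + M * a         ≡⟨ ℕP.+-comm (M * z) (M * a) ⟩
    M * a + M * z         ∎)
  where
  open ℕP.≤-Reasoning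
  z = suc z-1
  scaled : (z * a) * (z * a) + M * z ≤ M * (z * z + z * a)
  scaled = subst ((z * a) * (z * a) + M * z ≤_) (trans (sym (ℕP.*-distribˡ-+ M T z)) (cong (M *_) T+z)) (ℕP.+-monoˡ-≤ (M * z) cs)
  expand-D : ∀ z D M → z * D + M + M * z ≡ z * (D + M) + M
  expand-D = solve-∀
  factor-lhs : ∀ z a M → (z * a) * (z * a) + M * z ≡ z * (z * (a * a) + M)
  factor-lhs = solve-∀
  factor-rhs : ∀ z a M → M * (z * z + z * a) ≡ z * (M * z + M * a)
  factor-rhs = solve-∀

unital-square : ∀ n → 1 ≤ n → ∀ {L M y} → L + n ^ 3 ≡ n ^ 4 + n ^ 2 → M + y ≡ L →
  n ^ 2 * n ^ 2 ≡ (n ^ 2 * (n ∸ 1) + y) + M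
unital-square (suc k) _ {L} {M} {y} L+n³ M+y≡L = ℕP.+-cancelʳ-≡ (suc k ^ 2) _ _ (begin
  n ^ 2 * n ^ 2 + n ^ 2             ≡⟨ fourth-power k ⟩
  n ^ 4 + n ^ 2                     ≡⟨ sym L+n³ ⟩
  L + n ^ 3                         ≡⟨ cong (_+ n ^ 3) (sym M+y≡L) ⟩
  M + y + n ^ 3                     ≡⟨ cube k M y ⟩
  n ^ 2 * k + y + M + n ^ 2         ∎)
  where
  open ≡-Reasoning
  n = suc k
  fourth-power : ∀ k → suc k * (suc k * 1) * (suc k * (suc k * 1)) + suc k * (suc k * 1)
                       ≡ suc k * (suc k * (suc k * (suc k * 1))) + suc k * (suc k * 1)
  fourth-power = solve-∀
  cube : ∀ k M y → M + y + suc k * (suc k * (suc k * 1)) ≡ suc k * (suc k * 1) * k + y + M + suc k * (suc k * 1)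
  cube = solve-∀

neighbourhood-identity : ∀ n → 1 ≤ n → ∀ {L M y} → L + n ^ 3 ≡ n ^ 4 + n ^ 2 → M + y ≡ L →
  suc (n ^ 3) * (n ^ 2 * (n ∸ 1) + y) + M ≡ M * n ^ 2 + n ^ 2 * (n + 1) * y
neighbourhood-identity (suc k) _ {L} {M} {y} L+n³ M+y≡L =
  ℕP.+-cancelʳ-≡ (y * K + n ^ 3 * K) _ _ (begin
    N * D + M + (y * K + n ^ 3 * K)        ≡⟨ move-M (N * D) M (y * K) (n ^ 3 * K) ⟩
    M + (N * D + y * K + n ^ 3 * K)        ≡⟨ cong (_+_ M) (polynomial k y) ⟩
    M + ((n ^ 4 + n ^ 2) * K + c * y)      ≡⟨ cong (λ s → M + (s * K + c * y)) (sym (trans (cong (_+ n ^ 3) M+y≡L) L+n³)) ⟩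
    M + ((M + y + n ^ 3) * K + c * y)      ≡⟨ collect k M y ⟩
    M * n ^ 2 + c * y + (y * K + n ^ 3 * K) ∎)
  where
  open ≡-Reasoning
  n = suc k
  N = suc (n ^ 3)
  D = n ^ 2 * k + y
  K = k * (k + 2)
  c = n ^ 2 * (n + 1)
  move-M : ∀ a m s t → a + m + (s + t) ≡ m + (a + s + t)
  move-M = solve-∀
  polynomial : ∀ k y →
    suc (suc k * (suc k * (suc k * 1))) * (suc k * (suc k * 1) * k + y) + y * (k * (k + 2))
      + suc k * (suc k * (suc k * 1)) * (k * (k + 2))
    ≡ (suc k * (suc k * (suc k * (suc k * 1))) + suc k * (suc k * 1)) * (k * (k + 2))
      + suc k * (suc k * 1) * (suc k + 1) * y
  polynomial = solve-∀
  collect : ∀ k M y →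
    M + ((M + y + suc k * (suc k * (suc k * 1))) * (k * (k + 2)) + suc k * (suc k * 1) * (suc k + 1) * y)
    ≡ M * (suc k * (suc k * 1)) + suc k * (suc k * 1) * (suc k + 1) * y
      + (y * (k * (k + 2)) + suc k * (suc k * (suc k * 1)) * (k * (k + 2)))
  collect = solve-∀

consecutive-even : ∀ t → Σ ℕ λ h → t * suc t ≡ 2 * h
consecutive-even zero    = 0 , refl
consecutive-even (suc t) with consecutive-even t
... | h , t[t+1]≡2h = h + suc t , (begin
  suc t * suc (suc t)     ≡⟨ step t ⟩
  t * suc t + 2 * suc t   ≡⟨ cong (_+ 2 * suc t) t[t+1]≡2h ⟩
  2 * h + 2 * suc t       ≡⟨ sym (ℕP.*-distribˡ-+ 2 h (suc t)) ⟩
  2 * (h + suc t)         ∎)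
  where
  open ≡-Reasoning
  step : ∀ t → suc t * suc (suc t) ≡ t * suc t + 2 * suc t
  step = solve-∀

even≤odd : ∀ s h → 2 * s ≤ suc (2 * h) → 2 * s ≤ 2 * h
even≤odd s h 2s≤2h+1 = ℕP.*-monoʳ-≤ 2 (ℕ.s≤s⁻¹ (ℕP.*-cancelˡ-< 2 s (suc h)
  (ℕP.≤-trans (s≤s 2s≤2h+1) (ℕP.≤-reflexive (sym (ℕP.*-suc 2 h))))))

square-succ : ∀ n → (n + 1) ^ 2 ≡ suc n * suc n
square-succ n = cong₂ _*_ (ℕP.+-comm n 1) (trans (ℕP.*-identityʳ (n + 1)) (ℕP.+-comm n 1))

⟦_⟧ : Bool → ℕ
⟦ true  ⟧ = 1
⟦ false ⟧ = 0

⟦⟧-idem : ∀ a → ⟦ a ⟧ * ⟦ a ⟧ ≡ ⟦ a ⟧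
⟦⟧-idem true  = refl
⟦⟧-idem false = refl

⟦⟧+⟦not⟧ : ∀ a → ⟦ a ⟧ + ⟦ not a ⟧ ≡ 1
⟦⟧+⟦not⟧ true  = refl
⟦⟧+⟦not⟧ false = refl

χ : ∀ {m} → Subset m → Fin m → ℕ
χ S i = ⟦ lookup S i ⟧

∣∣≡∑χ : ∀ {m} (S : Subset m) → ∣ S ∣ ≡ sum (χ S)
∣∣≡∑χ []          = refl
∣∣≡∑χ (true  ∷ S) = cong suc (∣∣≡∑χ S)
∣∣≡∑χ (false ∷ S) = ∣∣≡∑χ S

lookup-─ : ∀ {m} (A B : Subset m) i → lookup (A ─ B) i ≡ (lookup A i ∧ not (lookup B i))
lookup-─ (a ∷ A) (b ∷ B) (suc i) = lookup-─ A B i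
lookup-─ (a ∷ A) (true  ∷ B) zero = sym (∧-zeroʳ a)
lookup-─ (a ∷ A) (false ∷ B) zero = sym (∧-identityʳ a)

-- Double
-- counting the pairs (q, b) with p, q ∈ b shows that every point lies on n²
-- lines, and then double counting flags gives the number of lines.
module Design {n : ℕ} (U : Unital n) where
  open Unital U

  Point : Set
  Point = Fin (suc (n ^ 3))

  I : Fin nLines → Point → ℕ
  I b p = χ (line b) p

  r : Point → ℕ
  r p = ∑[ b < nLines ] I b p

  joins : Point → Point → ℕ
  joins p q = ∑[ b < nLines ] (I b p * I b q)

  points-on-line : ∀ b → sum (I b) ≡ suc n
  points-on-line b = trans (sym (∣∣≡∑χ (line b))) (lineSize b)

  joins-self : ∀ p → joins p p ≡ r p
  joins-self p = sum-cong-≗ (λ b → ⟦⟧-idem (lookup (line b) p))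

  incidence-product : ∀ b p q → I b p * I b q ≡ 0 ⊎ (lookup (line b) p ≡ true × lookup (line b) q ≡ true)
  incidence-product b p q with lookup (line b) p | lookup (line b) q
  ... | true  | true  = inj₂ (refl , refl)
  ... | true  | false = inj₁ refl
  ... | false | _     = inj₁ refl

  joins-distinct : ∀ p q → p ≢ q → joins p q ≡ 1
  joins-distinct p q p≢q with twoPts p q p≢q
  ... | b , (p∈b , q∈b) , unique = ∑-single (λ c → I c p * I c q) b on-b off-b
    where
    on-b : I b p * I b q ≡ 1
    on-b rewrite []=⇒lookup p∈b | []=⇒lookup q∈b = refl
    off-b : ∀ c → c ≢ b → I c p * I c q ≡ 0
    off-b c c≢b with incidence-product c p q
    ... | inj₁ zero-product = zero-product
    ... | inj₂ (p∈c , q∈c) = ⊥-elim (c≢b (unique c (lookup⇒[]= p (line c) p∈c) (lookup⇒[]= q (line c) q∈c)))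

  joins-δ : ∀ p q → joins p q + δ p q ≡ 1 + δ p q * r p
  joins-δ p q with p ≟ᶠ q
  ... | yes refl rewrite δ-refl p | joins-self p = trans (ℕP.+-comm (r p) 1) (cong suc (sym (ℕP.+-identityʳ (r p))))
  ... | no p≢q   rewrite δ-≢ p≢q | joins-distinct p q p≢q = refl

  -- Each line through p contains n + 1 points q.
  ∑-joins : ∀ p → ∑[ q < suc (n ^ 3) ] joins p q ≡ r p * suc n
  ∑-joins p = begin
    ∑[ q < suc (n ^ 3) ] ∑[ b < nLines ] (I b p * I b q) ≡⟨ ∑-comm (λ q b → I b p * I b q) ⟩
    ∑[ b < nLines ] ∑[ q < suc (n ^ 3) ] (I b p * I b q) ≡⟨ sum-cong-≗ (λ b → sym (*-distribˡ-sum (I b p) (I b))) ⟩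
    ∑[ b < nLines ] (I b p * sum (I b))                  ≡⟨ sum-cong-≗ (λ b → cong (I b p *_) (points-on-line b)) ⟩
    ∑[ b < nLines ] (I b p * suc n)                      ≡⟨ sym (*-distribʳ-sum (suc n) (λ b → I b p)) ⟩
    r p * suc n                                          ∎
    where open ≡-Reasoning

  -- Every point lies on exactly n² lines: the pairs (q, b) with p, q ∈ b number
  -- r p · (n + 1), but also r p + n³, since q = p lies on all r p lines through p
  -- and each of the other n³ points on exactly one.
  replication : 1 ≤ n → ∀ p → r p ≡ n ^ 2
  replication 1≤n p = ℕP.*-cancelˡ-≡ (r p) (n ^ 2) n {{ℕ.>-nonZero 1≤n}}
    (ℕP.+-cancelʳ-≡ (suc (r p)) (n * r p) (n * n ^ 2) (begin
      n * r p + suc (r p)                                 ≡⟨ shuffle n (r p) ⟩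
      r p * suc n + 1                                     ≡⟨ cong₂ _+_ (sym (∑-joins p)) (sym (∑-δ p (λ _ → 1))) ⟩
      sum (joins p) + ∑[ q < suc (n ^ 3) ] (δ p q * 1)    ≡⟨ sym (∑-distrib-+ (joins p) (λ q → δ p q * 1)) ⟩
      ∑[ q < suc (n ^ 3) ] (joins p q + δ p q * 1)        ≡⟨ sum-cong-≗ (λ q → trans (cong (_+_ (joins p q)) (ℕP.*-identityʳ (δ p q))) (joins-δ p q)) ⟩
      ∑[ q < suc (n ^ 3) ] (1 + δ p q * r p)              ≡⟨ ∑-distrib-+ (λ _ → 1) (λ q → δ p q * r p) ⟩
      ∑[ q < suc (n ^ 3) ] 1 + ∑[ q < suc (n ^ 3) ] (δ p q * r p) ≡⟨ cong₂ _+_ (trans (∑-const (suc (n ^ 3)) 1) (ℕP.*-identityʳ _)) (∑-δ p (λ _ → r p)) ⟩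
      suc (n ^ 3) + r p                                   ≡⟨ sym (ℕP.+-suc (n ^ 3) (r p)) ⟩
      n * n ^ 2 + suc (r p)                               ∎))
    where
    open ≡-Reasoning
    shuffle : ∀ n r → n * r + suc r ≡ r * suc n + 1
    shuffle = solve-∀

  -- Counting flags (p, b) with p ∈ b in two ways.
  line-count : 1 ≤ n → nLines * suc n ≡ suc (n ^ 3) * n ^ 2
  line-count 1≤n = begin
    nLines * suc n                                        ≡⟨ sym (∑-const nLines (suc n)) ⟩
    ∑[ b < nLines ] (suc n)                               ≡⟨ sym (sum-cong-≗ points-on-line) ⟩
    ∑[ b < nLines ] ∑[ p < suc (n ^ 3) ] I b p            ≡⟨ ∑-comm I ⟩
    ∑[ p < suc (n ^ 3) ] r p                              ≡⟨ sum-cong-≗ (replication 1≤n) ⟩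
    ∑[ p < suc (n ^ 3) ] (n ^ 2)                           ≡⟨ ∑-const (suc (n ^ 3)) (n ^ 2) ⟩
    suc (n ^ 3) * n ^ 2                                   ∎
    where open ≡-Reasoning

  line-total : 1 ≤ n → nLines + n ^ 3 ≡ n ^ 4 + n ^ 2
  line-total 1≤n = ℕP.*-cancelʳ-≡ _ _ (suc n) (begin
    (nLines + n ^ 3) * suc n             ≡⟨ ℕP.*-distribʳ-+ (suc n) nLines (n ^ 3) ⟩
    nLines * suc n + n ^ 3 * suc n       ≡⟨ cong (_+ n ^ 3 * suc n) (line-count 1≤n) ⟩
    suc (n ^ 3) * n ^ 2 + n ^ 3 * suc n  ≡⟨ powers n ⟩
    (n ^ 4 + n ^ 2) * suc n              ∎)
    where
    open ≡-Reasoning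
    powers : ∀ n → suc (n * (n * (n * 1))) * (n * (n * 1)) + n * (n * (n * 1)) * suc n
                   ≡ (n * (n * (n * (n * 1))) + n * (n * 1)) * suc n
    powers = solve-∀

  -- The incidence graph has n⁴ + n² + 1 vertices, an odd number; so a vertex set
  -- of at most half of them has at most n²(n² + 1)/2 elements.
  half-vertices : 1 ≤ n → ∀ s → 2 * s ≤ (n ^ 3 + 1) + nLines → 2 * s ≤ n ^ 2 * (n ^ 2 + 1)
  half-vertices 1≤n s 2s≤V with consecutive-even (n ^ 2)
  ... | h , t[t+1]≡2h = subst (2 * s ≤_) (sym even) (even≤odd s h (subst (2 * s ≤_) (trans vertices (cong suc even)) 2s≤V))
    where
    even : n ^ 2 * (n ^ 2 + 1) ≡ 2 * h
    even = trans (cong (n ^ 2 *_) (ℕP.+-comm (n ^ 2) 1)) t[t+1]≡2h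
    vertices : (n ^ 3 + 1) + nLines ≡ suc (n ^ 2 * (n ^ 2 + 1))
    vertices = begin
      (n ^ 3 + 1) + nLines  ≡⟨ ℕP.+-comm (n ^ 3 + 1) nLines ⟩
      nLines + (n ^ 3 + 1)  ≡⟨ sym (ℕP.+-assoc nLines (n ^ 3) 1) ⟩
      nLines + n ^ 3 + 1    ≡⟨ cong (_+ 1) (line-total 1≤n) ⟩
      n ^ 4 + n ^ 2 + 1     ≡⟨ square n ⟩
      suc (n ^ 2 * (n ^ 2 + 1)) ∎
      where
      open ≡-Reasoning
      square : ∀ n → n * (n * (n * (n * 1))) + n * (n * 1) + 1 ≡ suc (n * (n * 1) * (n * (n * 1) + 1))
      square = solve-∀

module Neighbourhood {n : ℕ} (U : Unital n) where
  open Unital U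
  open Design U

  onY : Subset nLines → Point → Bool
  onY Y p = lookup (nbrPts U Y) p

  meetsX : Subset (suc (n ^ 3)) → Fin nLines → Bool
  meetsX X b = lookup (nbrLines U X) b

  onY-intro : ∀ Y b p → lookup Y b ≡ true → lookup (line b) p ≡ true → onY Y p ≡ true
  onY-intro Y b p b∈Y p∈b =
    trans (lookup∘tabulate (λ q → does (any? λ c → (c ∈? Y) ×-dec (q ∈? line c))) p)
          (dec-true (any? λ c → (c ∈? Y) ×-dec (p ∈? line c)) (b , lookup⇒[]= b Y b∈Y , lookup⇒[]= p (line b) p∈b))

  meetsX-intro : ∀ X b p → lookup X p ≡ true → lookup (line b) p ≡ true → meetsX X b ≡ true
  meetsX-intro X b p p∈X p∈b =
    trans (lookup∘tabulate (λ c → does (any? λ q → (q ∈? X) ×-dec (q ∈? line c))) b)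
          (dec-true (any? λ q → (q ∈? X) ×-dec (q ∈? line b)) (p , lookup⇒[]= p X p∈X , lookup⇒[]= p (line b) p∈b))

  -- Each pair
  -- (p, q) ∈ X × far is joined by a line of N(X) ∖ Y, and such a line b, meeting X
  -- in a points and the far set in c points with a + c ≤ n + 1, carries
  -- ac ≤ (n+1)²/4 of these pairs.
  module FarPoints (X : Subset (suc (n ^ 3))) (Y : Subset nLines) where

    far : Point → Bool
    far p = not (lookup X p ∨ onY Y p)

    #far : ℕ
    #far = ∑[ p < suc (n ^ 3) ] ⟦ far p ⟧

    partition : ∣ X ∣ + x′ U X Y + #far ≡ suc (n ^ 3)
    partition = begin
      ∣ X ∣ + x′ U X Y + #far
        ≡⟨ cong₂ (λ a b → a + b + #far) (∣∣≡∑χ X) (∣∣≡∑χ (nbrPts U Y ─ X)) ⟩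
      sum (χ X) + sum (χ (nbrPts U Y ─ X)) + #far
        ≡⟨ cong (_+ #far) (sym (∑-distrib-+ (χ X) (χ (nbrPts U Y ─ X)))) ⟩
      ∑[ p < suc (n ^ 3) ] (χ X p + χ (nbrPts U Y ─ X) p) + #far
        ≡⟨ sym (∑-distrib-+ (λ p → χ X p + χ (nbrPts U Y ─ X) p) (λ p → ⟦ far p ⟧)) ⟩
      ∑[ p < suc (n ^ 3) ] (χ X p + χ (nbrPts U Y ─ X) p + ⟦ far p ⟧)
        ≡⟨ sum-cong-≗ pointwise ⟩
      ∑[ p < suc (n ^ 3) ] 1
        ≡⟨ trans (∑-const (suc (n ^ 3)) 1) (ℕP.*-identityʳ _) ⟩
      suc (n ^ 3) ∎
      where
      open ≡-Reasoning
      pointwise : ∀ p → χ X p + χ (nbrPts U Y ─ X) p + ⟦ far p ⟧ ≡ 1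
      pointwise p rewrite lookup-─ (nbrPts U Y) X p with lookup X p | onY Y p
      ... | true  | true  = refl
      ... | true  | false = refl
      ... | false | true  = refl
      ... | false | false = refl

    inX inFar : Fin nLines → ℕ
    inX   b = ∑[ p < suc (n ^ 3) ] (I b p * χ X p)
    inFar b = ∑[ p < suc (n ^ 3) ] (I b p * ⟦ far p ⟧)

    inX-outside : ∀ b → meetsX X b ≡ false → inX b ≡ 0
    inX-outside b b∉NX = ∑-zero pointwise
      where
      pointwise : ∀ p → I b p * χ X p ≡ 0
      pointwise p with lookup (line b) p in p∈b | lookup X p in p∈X
      ... | true  | true  with () ← trans (sym b∉NX) (meetsX-intro X b p p∈X p∈b)
      ... | true  | false = refl
      ... | false | _     = refl

    inFar-Y : ∀ b → lookup Y b ≡ true → inFar b ≡ 0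
    inFar-Y b b∈Y = ∑-zero pointwise
      where
      pointwise : ∀ p → I b p * ⟦ far p ⟧ ≡ 0
      pointwise p with lookup (line b) p in p∈b
      ... | false = refl
      ... | true rewrite onY-intro Y b p b∈Y p∈b with lookup X p
      ...   | true  = refl
      ...   | false = refl

    -- X and the far set are disjoint, so a line meets them in at most n + 1 points.
    inX+inFar≤ : ∀ b → inX b + inFar b ≤ suc n
    inX+inFar≤ b = subst₂ _≤_ (∑-distrib-+ (λ p → I b p * χ X p) (λ p → I b p * ⟦ far p ⟧))
                              (points-on-line b) (∑-mono-≤ pointwise)
      where
      pointwise : ∀ p → I b p * χ X p + I b p * ⟦ far p ⟧ ≤ I b p
      pointwise p with lookup (line b) p | lookup X p | onY Y p
      ... | false | _     | _     = z≤n
      ... | true  | true  | _     = ℕP.≤-refl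
      ... | true  | false | true  = z≤n
      ... | true  | false | false = ℕP.≤-refl

    per-line : ∀ b → 4 * (inX b * inFar b) ≤ χ (nbrLines U X ─ Y) b * (suc n * suc n)
    per-line b rewrite lookup-─ (nbrLines U X) Y b with meetsX X b in b∈NX | lookup Y b in b∈Y
    ... | false | _     rewrite inX-outside b b∈NX = z≤n
    ... | true  | true  rewrite inFar-Y b b∈Y | ℕP.*-zeroʳ (inX b) = z≤n
    ... | true  | false = subst (4 * (inX b * inFar b) ≤_) (sym (ℕP.+-identityʳ (suc n * suc n)))
                                (4ab≤c² {inX b} {inFar b} (inX+inFar≤ b))

    -- Distinct points are joined by a line, and X is disjoint from the far set,
    -- so the pairs in X × far inject into the flags (b, p, q) with p, q ∈ b.
    pairs≤ : ∣ X ∣ * #far ≤ ∑[ b < nLines ] (inX b * inFar b)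
    pairs≤ = begin
      ∣ X ∣ * #far
        ≡⟨ cong (_* #far) (∣∣≡∑χ X) ⟩
      sum (χ X) * #far
        ≡⟨ ∑-product (χ X) (λ q → ⟦ far q ⟧) ⟩
      ∑[ p < suc (n ^ 3) ] ∑[ q < suc (n ^ 3) ] (χ X p * ⟦ far q ⟧)
        ≤⟨ ∑-mono-≤ (λ p → ∑-mono-≤ (λ q → joined p q)) ⟩
      ∑[ p < suc (n ^ 3) ] ∑[ q < suc (n ^ 3) ] (χ X p * ⟦ far q ⟧ * joins p q)
        ≡⟨ sum-cong-≗ (λ p → sum-cong-≗ (λ q → *-distribˡ-sum (χ X p * ⟦ far q ⟧) (λ b → I b p * I b q))) ⟩
      ∑[ p < suc (n ^ 3) ] ∑[ q < suc (n ^ 3) ] ∑[ b < nLines ] (χ X p * ⟦ far q ⟧ * (I b p * I b q))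
        ≡⟨ sum-cong-≗ (λ p → ∑-comm (λ q b → χ X p * ⟦ far q ⟧ * (I b p * I b q))) ⟩
      ∑[ p < suc (n ^ 3) ] ∑[ b < nLines ] ∑[ q < suc (n ^ 3) ] (χ X p * ⟦ far q ⟧ * (I b p * I b q))
        ≡⟨ ∑-comm (λ p b → ∑[ q < suc (n ^ 3) ] (χ X p * ⟦ far q ⟧ * (I b p * I b q))) ⟩
      ∑[ b < nLines ] ∑[ p < suc (n ^ 3) ] ∑[ q < suc (n ^ 3) ] (χ X p * ⟦ far q ⟧ * (I b p * I b q))
        ≡⟨ sum-cong-≗ (λ b → sum-cong-≗ (λ p → sum-cong-≗ (λ q → regroup (χ X p) (⟦ far q ⟧) (I b p) (I b q)))) ⟩
      ∑[ b < nLines ] ∑[ p < suc (n ^ 3) ] ∑[ q < suc (n ^ 3) ] ((I b p * χ X p) * (I b q * ⟦ far q ⟧))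
        ≡⟨ sum-cong-≗ (λ b → sym (∑-product (λ p → I b p * χ X p) (λ q → I b q * ⟦ far q ⟧))) ⟩
      ∑[ b < nLines ] (inX b * inFar b) ∎
      where
      open ℕP.≤-Reasoning
      regroup : ∀ u v s t → u * v * (s * t) ≡ (s * u) * (t * v)
      regroup = solve-∀
      joined : ∀ p q → χ X p * ⟦ far q ⟧ ≤ χ X p * ⟦ far q ⟧ * joins p q
      joined p q with p ≟ᶠ q
      ... | no p≢q rewrite joins-distinct p q p≢q = ℕP.≤-reflexive (sym (ℕP.*-identityʳ _))
      ... | yes refl with lookup X p
      ...   | true  = z≤n
      ...   | false = z≤n

    far-bound : 4 * (∣ X ∣ * #far) ≤ y′ U X Y * (suc n * suc n)
    far-bound = begin
      4 * (∣ X ∣ * #far)                                        ≤⟨ ℕP.*-monoʳ-≤ 4 pairs≤ ⟩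
      4 * ∑[ b < nLines ] (inX b * inFar b)                     ≡⟨ *-distribˡ-sum 4 (λ b → inX b * inFar b) ⟩
      ∑[ b < nLines ] (4 * (inX b * inFar b))                   ≤⟨ ∑-mono-≤ per-line ⟩
      ∑[ b < nLines ] (χ (nbrLines U X ─ Y) b * (suc n * suc n)) ≡⟨ sym (*-distribʳ-sum (suc n * suc n) (χ (nbrLines U X ─ Y))) ⟩
      sum (χ (nbrLines U X ─ Y)) * (suc n * suc n)              ≡⟨ cong (_* (suc n * suc n)) (sym (∣∣≡∑χ (nbrLines U X ─ Y))) ⟩
      y′ U X Y * (suc n * suc n)                                ∎
      where open ℕP.≤-Reasoning

  -- Lines of Y have e b = 0,
  -- ∑ e = z·n² (each point is on n² lines) and ∑ e² = z(z - 1) + z·n² (pairs of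
  -- points off N(Y) are joined once); Cauchy–Schwarz over the M lines outside Y
  -- then bounds z, i.e. it forces N(Y) to be large.
  module LinesOfY (1≤n : 1 ≤ n) (Y : Subset nLines) where

    off : Point → ℕ
    off p = ⟦ not (onY Y p) ⟧

    outY : Fin nLines → ℕ
    outY b = ⟦ not (lookup Y b) ⟧

    e : Fin nLines → ℕ
    e b = ∑[ p < suc (n ^ 3) ] (I b p * off p)

    z #NY M : ℕ
    z   = sum off
    #NY = ∑[ p < suc (n ^ 3) ] ⟦ onY Y p ⟧
    M   = sum outY

    #NY+z : #NY + z ≡ suc (n ^ 3)
    #NY+z = trans (sym (∑-distrib-+ (λ p → ⟦ onY Y p ⟧) off))
                  (trans (sum-cong-≗ (λ p → ⟦⟧+⟦not⟧ (onY Y p))) (trans (∑-const (suc (n ^ 3)) 1) (ℕP.*-identityʳ _)))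

    M+y : M + ∣ Y ∣ ≡ nLines
    M+y = trans (cong (_+_ M) (∣∣≡∑χ Y))
          (trans (sym (∑-distrib-+ outY (χ Y)))
          (trans (sum-cong-≗ (λ b → trans (ℕP.+-comm (outY b) (χ Y b)) (⟦⟧+⟦not⟧ (lookup Y b))))
                 (trans (∑-const nLines 1) (ℕP.*-identityʳ nLines))))

    #NY≤ : ∀ X → #NY ≤ ∣ X ∣ + x′ U X Y
    #NY≤ X = subst₂ _≤_ refl (trans (∑-distrib-+ (χ X) (χ (nbrPts U Y ─ X)))
                                     (sym (cong₂ _+_ (∣∣≡∑χ X) (∣∣≡∑χ (nbrPts U Y ─ X)))))
                   (∑-mono-≤ pointwise)
      where
      pointwise : ∀ p → ⟦ onY Y p ⟧ ≤ χ X p + χ (nbrPts U Y ─ X) p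
      pointwise p rewrite lookup-─ (nbrPts U Y) X p with onY Y p | lookup X p
      ... | true  | true  = s≤s z≤n
      ... | true  | false = s≤s z≤n
      ... | false | _     = z≤n

    e-Y : ∀ b → lookup Y b ≡ true → e b ≡ 0
    e-Y b b∈Y = ∑-zero pointwise
      where
      pointwise : ∀ p → I b p * off p ≡ 0
      pointwise p with lookup (line b) p in p∈b
      ... | false = refl
      ... | true rewrite onY-intro Y b p b∈Y p∈b = refl

    ∑e : sum e ≡ z * n ^ 2
    ∑e = begin
      ∑[ b < nLines ] ∑[ p < suc (n ^ 3) ] (I b p * off p) ≡⟨ ∑-comm (λ b p → I b p * off p) ⟩
      ∑[ p < suc (n ^ 3) ] ∑[ b < nLines ] (I b p * off p) ≡⟨ sum-cong-≗ (λ p → sym (*-distribʳ-sum (off p) (λ b → I b p))) ⟩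
      ∑[ p < suc (n ^ 3) ] (r p * off p)                   ≡⟨ sum-cong-≗ (λ p → cong (_* off p) (replication 1≤n p)) ⟩
      ∑[ p < suc (n ^ 3) ] (n ^ 2 * off p)                 ≡⟨ sym (*-distribˡ-sum (n ^ 2) off) ⟩
      n ^ 2 * z                                            ≡⟨ ℕP.*-comm (n ^ 2) z ⟩
      z * n ^ 2                                            ∎
      where open ≡-Reasoning

    F : Point → ℕ
    F p = ∑[ q < suc (n ^ 3) ] (off q * joins p q)

    F+off : ∀ p → F p + off p ≡ z + off p * n ^ 2
    F+off p = begin
      F p + off p
        ≡⟨ cong (_+_ (F p)) (sym (∑-δ p off)) ⟩
      F p + ∑[ q < suc (n ^ 3) ] (δ p q * off q)
        ≡⟨ sym (∑-distrib-+ (λ q → off q * joins p q) (λ q → δ p q * off q)) ⟩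
      ∑[ q < suc (n ^ 3) ] (off q * joins p q + δ p q * off q)
        ≡⟨ sum-cong-≗ pointwise ⟩
      ∑[ q < suc (n ^ 3) ] (off q + δ p q * (off q * r p))
        ≡⟨ ∑-distrib-+ off (λ q → δ p q * (off q * r p)) ⟩
      z + ∑[ q < suc (n ^ 3) ] (δ p q * (off q * r p))
        ≡⟨ cong (_+_ z) (∑-δ p (λ q → off q * r p)) ⟩
      z + off p * r p
        ≡⟨ cong (λ k → z + off p * k) (replication 1≤n p) ⟩
      z + off p * n ^ 2 ∎
      where
      open ≡-Reasoning
      expand : ∀ a j d r → a * (j + d) ≡ a * (1 + d * r) → a * j + d * a ≡ a + d * (a * r)
      expand a j d r eq = trans (lhs a j d) (trans eq (rhs a d r))
        where
        lhs : ∀ a j d → a * j + d * a ≡ a * (j + d)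
        lhs = solve-∀
        rhs : ∀ a d r → a * (1 + d * r) ≡ a + d * (a * r)
        rhs = solve-∀
      pointwise : ∀ q → off q * joins p q + δ p q * off q ≡ off q + δ p q * (off q * r p)
      pointwise q = expand (off q) (joins p q) (δ p q) (r p) (cong (off q *_) (joins-δ p q))

    ∑e² : sum (λ b → e b * e b) ≡ ∑[ p < suc (n ^ 3) ] (off p * F p)
    ∑e² = begin
      ∑[ b < nLines ] (e b * e b)
        ≡⟨ sum-cong-≗ (λ b → ∑-product (λ p → I b p * off p) (λ q → I b q * off q)) ⟩
      ∑[ b < nLines ] ∑[ p < suc (n ^ 3) ] ∑[ q < suc (n ^ 3) ] ((I b p * off p) * (I b q * off q))
        ≡⟨ ∑-comm (λ b p → ∑[ q < suc (n ^ 3) ] ((I b p * off p) * (I b q * off q))) ⟩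
      ∑[ p < suc (n ^ 3) ] ∑[ b < nLines ] ∑[ q < suc (n ^ 3) ] ((I b p * off p) * (I b q * off q))
        ≡⟨ sum-cong-≗ (λ p → ∑-comm (λ b q → (I b p * off p) * (I b q * off q))) ⟩
      ∑[ p < suc (n ^ 3) ] ∑[ q < suc (n ^ 3) ] ∑[ b < nLines ] ((I b p * off p) * (I b q * off q))
        ≡⟨ sum-cong-≗ (λ p → sum-cong-≗ (λ q → sum-cong-≗ (λ b → regroup (I b p) (off p) (I b q) (off q)))) ⟩
      ∑[ p < suc (n ^ 3) ] ∑[ q < suc (n ^ 3) ] ∑[ b < nLines ] (off p * off q * (I b p * I b q))
        ≡⟨ sum-cong-≗ (λ p → sum-cong-≗ (λ q → sym (*-distribˡ-sum (off p * off q) (λ b → I b p * I b q)))) ⟩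
      ∑[ p < suc (n ^ 3) ] ∑[ q < suc (n ^ 3) ] (off p * off q * joins p q)
        ≡⟨ sum-cong-≗ (λ p → trans (sum-cong-≗ (λ q → ℕP.*-assoc (off p) (off q) (joins p q)))
                                    (sym (*-distribˡ-sum (off p) (λ q → off q * joins p q)))) ⟩
      ∑[ p < suc (n ^ 3) ] (off p * F p) ∎
      where
      open ≡-Reasoning
      regroup : ∀ a b c d → (a * b) * (c * d) ≡ (b * d) * (a * c)
      regroup = solve-∀

    ∑e²+z : sum (λ b → e b * e b) + z ≡ z * z + z * n ^ 2
    ∑e²+z = begin
      sum (λ b → e b * e b) + z
        ≡⟨ cong₂ _+_ ∑e² (sum-cong-≗ (λ p → sym (⟦⟧-idem (not (onY Y p))))) ⟩
      ∑[ p < suc (n ^ 3) ] (off p * F p) + ∑[ p < suc (n ^ 3) ] (off p * off p)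
        ≡⟨ sym (∑-distrib-+ (λ p → off p * F p) (λ p → off p * off p)) ⟩
      ∑[ p < suc (n ^ 3) ] (off p * F p + off p * off p)
        ≡⟨ sum-cong-≗ pointwise ⟩
      ∑[ p < suc (n ^ 3) ] (off p * z + off p * n ^ 2)
        ≡⟨ ∑-distrib-+ (λ p → off p * z) (λ p → off p * n ^ 2) ⟩
      ∑[ p < suc (n ^ 3) ] (off p * z) + ∑[ p < suc (n ^ 3) ] (off p * n ^ 2)
        ≡⟨ sym (cong₂ _+_ (*-distribʳ-sum z off) (*-distribʳ-sum (n ^ 2) off)) ⟩
      z * z + z * n ^ 2 ∎
      where
      open ≡-Reasoning
      pointwise : ∀ p → off p * F p + off p * off p ≡ off p * z + off p * n ^ 2
      pointwise p = begin
        off p * F p + off p * off p         ≡⟨ sym (ℕP.*-distribˡ-+ (off p) (F p) (off p)) ⟩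
        off p * (F p + off p)               ≡⟨ cong (off p *_) (F+off p) ⟩
        off p * (z + off p * n ^ 2)         ≡⟨ ℕP.*-distribˡ-+ (off p) z (off p * n ^ 2) ⟩
        off p * z + off p * (off p * n ^ 2) ≡⟨ cong (_+_ (off p * z)) (sym (ℕP.*-assoc (off p) (off p) (n ^ 2))) ⟩
        off p * z + off p * off p * n ^ 2   ≡⟨ cong (λ k → off p * z + k * n ^ 2) (⟦⟧-idem (not (onY Y p))) ⟩
        off p * z + off p * n ^ 2           ∎

    -- Cauchy–Schwarz over the lines outside Y, which carry all of ∑ e.
    cauchy-schwarz-Y : sum e * sum e ≤ M * sum (λ b → e b * e b)
    cauchy-schwarz-Y = subst₂ _≤_ (cong₂ _*_ (sum-cong-≗ outY·e) (sum-cong-≗ outY·e))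
                                  (cong (_* sum (λ b → e b * e b)) (sum-cong-≗ (λ b → ⟦⟧-idem (not (lookup Y b)))))
                                  (cauchy-schwarz outY e)
      where
      outY·e : ∀ b → outY b * e b ≡ e b
      outY·e b with lookup Y b in b∈Y
      ... | true  = sym (e-Y b b∈Y)
      ... | false = ℕP.+-identityʳ (e b)

    neighbourhood-bound : n ^ 2 * (n + 1) * ∣ Y ∣ ≤ #NY * (n ^ 2 * (n ∸ 1) + ∣ Y ∣)
    neighbourhood-bound = ℕP.+-cancelʳ-≤ (z * D + M) _ _ (begin
      c * ∣ Y ∣ + (z * D + M)         ≡⟨ ℕP.+-comm (c * ∣ Y ∣) (z * D + M) ⟩
      z * D + M + c * ∣ Y ∣           ≤⟨ ℕP.+-monoˡ-≤ (c * ∣ Y ∣) cs-bound ⟩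
      M * n ^ 2 + c * ∣ Y ∣           ≡⟨ sym (neighbourhood-identity n 1≤n (line-total 1≤n) M+y) ⟩
      suc (n ^ 3) * D + M             ≡⟨ cong (λ s → s * D + M) (sym #NY+z) ⟩
      (#NY + z) * D + M               ≡⟨ cong (_+ M) (ℕP.*-distribʳ-+ D #NY z) ⟩
      #NY * D + z * D + M             ≡⟨ ℕP.+-assoc (#NY * D) (z * D) M ⟩
      #NY * D + (z * D + M)           ∎)
      where
      open ℕP.≤-Reasoning
      D = n ^ 2 * (n ∸ 1) + ∣ Y ∣
      c = n ^ 2 * (n + 1)
      cs-bound : z * D + M ≤ M * n ^ 2
      cs-bound = linearised-cs z (ℕP.*-mono-≤ 1≤n (ℕP.*-mono-≤ 1≤n ℕP.≤-refl))
                   (unital-square n 1≤n (line-total 1≤n) M+y) ∑e²+z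
                   (subst (λ s → s * s ≤ M * sum (λ b → e b * e b)) ∑e cauchy-schwarz-Y)

-- The embeddings ℤ → ℚ and ℕ → ℚ are ordered ring homomorphisms; they are
-- checked through the unnormalised rationals, where k / 1 is literally mkℚᵘ k 0.
ℤ→ℚᵘ : ∀ a → ℚ.toℚᵘ (ℤ→ℚ a) ℚᵘ.≃ mkℚᵘ a 0
ℤ→ℚᵘ a = ℚP.toℚᵘ-fromℚᵘ (mkℚᵘ a 0)

ℤ→ℚ-+ : ∀ a b → ℤ→ℚ (a ℤ.+ b) ≡ ℤ→ℚ a ℚ.+ ℤ→ℚ b
ℤ→ℚ-+ a b = ℚP.toℚᵘ-injective (ℚᵘP.≃-trans (ℤ→ℚᵘ (a ℤ.+ b)) (ℚᵘP.≃-trans over-1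
  (ℚᵘP.≃-sym (ℚᵘP.≃-trans (ℚP.toℚᵘ-homo-+ (ℤ→ℚ a) (ℤ→ℚ b)) (ℚᵘP.+-cong (ℤ→ℚᵘ a) (ℤ→ℚᵘ b))))))
  where
  over-1 : mkℚᵘ (a ℤ.+ b) 0 ℚᵘ.≃ (mkℚᵘ a 0 ℚᵘ.+ mkℚᵘ b 0)
  over-1 = *≡* (cong (ℤ._* + 1) (cong₂ ℤ._+_ (sym (ℤP.*-identityʳ a)) (sym (ℤP.*-identityʳ b))))

ℤ→ℚ-* : ∀ a b → ℤ→ℚ (a ℤ.* b) ≡ ℤ→ℚ a ℚ.* ℤ→ℚ b
ℤ→ℚ-* a b = ℚP.toℚᵘ-injective (ℚᵘP.≃-trans (ℤ→ℚᵘ (a ℤ.* b))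
  (ℚᵘP.≃-sym (ℚᵘP.≃-trans (ℚP.toℚᵘ-homo-* (ℤ→ℚ a) (ℤ→ℚ b)) (ℚᵘP.*-cong (ℤ→ℚᵘ a) (ℤ→ℚᵘ b)))))

ℤ→ℚ-neg : ∀ a → ℤ→ℚ (ℤ.- a) ≡ ℚ.- ℤ→ℚ a
ℤ→ℚ-neg a = ℚP.toℚᵘ-injective (ℚᵘP.≃-trans (ℤ→ℚᵘ (ℤ.- a))
  (ℚᵘP.≃-sym (ℚᵘP.≃-trans (ℚP.toℚᵘ-homo‿- (ℤ→ℚ a)) (ℚᵘP.-‿cong (ℤ→ℚᵘ a)))))

ℤ→ℚ-mono-≤ : ∀ {a b} → a ℤ.≤ b → ℤ→ℚ a ℚ.≤ ℤ→ℚ b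
ℤ→ℚ-mono-≤ {a} {b} a≤b = ℚP.toℚᵘ-cancel-≤
  (ℚᵘP.≤-respˡ-≃ (ℚᵘP.≃-sym (ℤ→ℚᵘ a)) (ℚᵘP.≤-respʳ-≃ (ℚᵘP.≃-sym (ℤ→ℚᵘ b))
    (*≤* (subst₂ ℤ._≤_ (sym (ℤP.*-identityʳ a)) (sym (ℤP.*-identityʳ b)) a≤b))))

ℤ→ℚ-cancel-≤ : ∀ {a b} → ℤ→ℚ a ℚ.≤ ℤ→ℚ b → a ℤ.≤ b
ℤ→ℚ-cancel-≤ {a} {b} a≤b with ℚᵘP.≤-respˡ-≃ (ℤ→ℚᵘ a) (ℚᵘP.≤-respʳ-≃ (ℤ→ℚᵘ b) (ℚP.toℚᵘ-mono-≤ a≤b))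
... | *≤* a*1≤b*1 = subst₂ ℤ._≤_ (ℤP.*-identityʳ a) (ℤP.*-identityʳ b) a*1≤b*1

ℤ→ℚ-cancel-< : ∀ {a b} → ℤ→ℚ a ℚ.< ℤ→ℚ b → a ℤ.< b
ℤ→ℚ-cancel-< {a} {b} a<b with ℚᵘP.<-respˡ-≃ (ℤ→ℚᵘ a) (ℚᵘP.<-respʳ-≃ (ℤ→ℚᵘ b) (ℚP.toℚᵘ-mono-< a<b))
... | *<* a*1<b*1 = subst₂ ℤ._<_ (ℤP.*-identityʳ a) (ℤP.*-identityʳ b) a*1<b*1

ℕ→ℚ-+ : ∀ a b → ℕ→ℚ (a + b) ≡ ℕ→ℚ a ℚ.+ ℕ→ℚ b
ℕ→ℚ-+ a b = ℤ→ℚ-+ (+ a) (+ b)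

ℕ→ℚ-* : ∀ a b → ℕ→ℚ (a * b) ≡ ℕ→ℚ a ℚ.* ℕ→ℚ b
ℕ→ℚ-* a b = trans (cong ℤ→ℚ (ℤP.pos-* a b)) (ℤ→ℚ-* (+ a) (+ b))

ℕ→ℚ-mono-≤ : ∀ {a b} → a ≤ b → ℕ→ℚ a ℚ.≤ ℕ→ℚ b
ℕ→ℚ-mono-≤ a≤b = ℤ→ℚ-mono-≤ (ℤ.+≤+ a≤b)

ℕ→ℚ-cancel-≤ : ∀ {a b} → ℕ→ℚ a ℚ.≤ ℕ→ℚ b → a ≤ b
ℕ→ℚ-cancel-≤ a≤b = ℤP.drop‿+≤+ (ℤ→ℚ-cancel-≤ a≤b)

ℕ→ℚ-cancel-< : ∀ {a b} → ℕ→ℚ a ℚ.< ℕ→ℚ b → a < b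
ℕ→ℚ-cancel-< a<b = ℤP.drop‿+<+ (ℤ→ℚ-cancel-< a<b)

÷ℕ-*-cancel : ∀ q {d} → 0 < d → (q ÷ℕ d) ℚ.* ℕ→ℚ d ≡ q
÷ℕ-*-cancel q {suc d} _ = begin
  q ℚ.* (+ 1 / suc d) ℚ.* ℕ→ℚ (suc d)   ≡⟨ ℚP.*-assoc q (+ 1 / suc d) (ℕ→ℚ (suc d)) ⟩
  q ℚ.* ((+ 1 / suc d) ℚ.* ℕ→ℚ (suc d)) ≡⟨ cong (q ℚ.*_) inverse ⟩
  q ℚ.* 1ℚ                              ≡⟨ ℚP.*-identityʳ q ⟩
  q                                     ∎
  where
  open ≡-Reasoning
  inverse : (+ 1 / suc d) ℚ.* ℕ→ℚ (suc d) ≡ 1ℚ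
  inverse = ℚP.toℚᵘ-injective (ℚᵘP.≃-trans (ℚP.toℚᵘ-homo-* (+ 1 / suc d) (ℕ→ℚ (suc d)))
              (ℚᵘP.≃-trans (ℚᵘP.*-cong (ℚP.toℚᵘ-fromℚᵘ (mkℚᵘ (+ 1) d)) (ℤ→ℚᵘ (+ suc d)))
                (*≡* (trans (ℤP.*-identityʳ _) (trans (ℤP.*-identityˡ _)
                       (cong (λ k → + suc k) (sym (trans (ℕP.+-identityʳ (d * 1)) (ℕP.*-identityʳ d)))))))))

÷ℕ-*ʳ : ∀ q r d → (q ÷ℕ d) ℚ.* r ≡ (q ℚ.* r) ÷ℕ d
÷ℕ-*ʳ q r zero    = ℚP.*-zeroˡ r
÷ℕ-*ʳ q r (suc d) = trans (ℚP.*-assoc q _ r) (trans (cong (q ℚ.*_) (ℚP.*-comm _ r)) (sym (ℚP.*-assoc q r _)))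

÷ℕ-mono-≤ : ∀ {p q} d → p ℚ.≤ q → p ÷ℕ d ℚ.≤ q ÷ℕ d
÷ℕ-mono-≤ zero    p≤q = ℚP.≤-refl
÷ℕ-mono-≤ (suc d) p≤q = ℚP.*-monoʳ-≤-nonNeg (+ 1 / suc d) {{ℚP.normalize-nonNeg 1 (suc d)}} p≤q

*ℕ-cancel-≤ : ∀ {p q d} → 0 < d → p ℚ.* ℕ→ℚ d ℚ.≤ q ℚ.* ℕ→ℚ d → p ℚ.≤ q
*ℕ-cancel-≤ {d = suc d} _ = ℚP.*-cancelʳ-≤-pos (ℕ→ℚ (suc d)) {{ℚP.normalize-pos (suc d) 1}}

*ℕ-mono-≤ : ∀ {p q} d → p ℚ.≤ q → p ℚ.* ℕ→ℚ d ℚ.≤ q ℚ.* ℕ→ℚ d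
*ℕ-mono-≤ d = ℚP.*-monoʳ-≤-nonNeg (ℕ→ℚ d) {{ℚP.normalize-nonNeg d 1}}

*ℕ-mono-< : ∀ {p q d} → 0 < d → p ℚ.< q → p ℚ.* ℕ→ℚ d ℚ.< q ℚ.* ℕ→ℚ d
*ℕ-mono-< {d = suc d} _ = ℚP.*-monoˡ-<-pos (ℕ→ℚ (suc d)) {{ℚP.normalize-pos (suc d) 1}}

÷ℕ-≤ : ∀ {p q} d → 0 < d → p ℚ.≤ q ℚ.* ℕ→ℚ d → p ÷ℕ d ℚ.≤ q
÷ℕ-≤ {p} {q} d 0<d p≤qd = *ℕ-cancel-≤ 0<d (subst (ℚ._≤ q ℚ.* ℕ→ℚ d) (sym (÷ℕ-*-cancel p 0<d)) p≤qd)

≤-÷ℕ : ∀ {p q} d → 0 < d → p ℚ.* ℕ→ℚ d ℚ.≤ q → p ℚ.≤ q ÷ℕ d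
≤-÷ℕ {p} {q} d 0<d pd≤q = *ℕ-cancel-≤ 0<d (subst (p ℚ.* ℕ→ℚ d ℚ.≤_) (sym (÷ℕ-*-cancel q 0<d)) pd≤q)

÷ℕ-cross : ∀ {p q d s} → 0 < d → 0 < s → p ℚ.* ℕ→ℚ s ℚ.≤ q ℚ.* ℕ→ℚ d → p ÷ℕ d ℚ.≤ q ÷ℕ s
÷ℕ-cross {p} {q} {d} {s} 0<d 0<s ps≤qd =
  ≤-÷ℕ s 0<s (subst (ℚ._≤ q) (sym (÷ℕ-*ʳ p (ℕ→ℚ s) d)) (÷ℕ-≤ d 0<d ps≤qd))

≤-÷ℕ⁻¹ : ∀ {p q} d → 0 < d → p ℚ.≤ q ÷ℕ d → p ℚ.* ℕ→ℚ d ℚ.≤ q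
≤-÷ℕ⁻¹ {p} {q} d 0<d p≤q/d = subst (p ℚ.* ℕ→ℚ d ℚ.≤_) (÷ℕ-*-cancel q 0<d) (*ℕ-mono-≤ d p≤q/d)

÷ℕ-<⁻¹ : ∀ {p q} d → 0 < d → q ÷ℕ d ℚ.< p → q ℚ.< p ℚ.* ℕ→ℚ d
÷ℕ-<⁻¹ {p} {q} d 0<d q/d<p = subst (ℚ._< p ℚ.* ℕ→ℚ d) (÷ℕ-*-cancel q 0<d) (*ℕ-mono-< 0<d q/d<p)

2T/d≤Q/s : ∀ {T Q d s} → 0 < d → 0 < s → T ℤ.≤ + Q → 2 * s ≤ d →
           ℤ→ℚ (+ 2 ℤ.* T) ÷ℕ d ℚ.≤ ℕ→ℚ Q ÷ℕ s
2T/d≤Q/s {T} {Q} {d} {s} 0<d 0<s T≤Q 2s≤d = ÷ℕ-cross 0<d 0<s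
  (subst₂ ℚ._≤_ (ℤ→ℚ-* (+ 2 ℤ.* T) (+ s)) (ℤ→ℚ-* (+ Q) (+ d)) (ℤ→ℚ-mono-≤ (begin
    + 2 ℤ.* T ℤ.* + s   ≤⟨ ℤP.*-monoʳ-≤-nonNeg (+ s) (ℤP.*-monoˡ-≤-nonNeg (+ 2) T≤Q) ⟩
    + 2 ℤ.* + Q ℤ.* + s ≡⟨ sym (trans (ℤP.pos-* (2 * Q) s) (cong (ℤ._* + s) (ℤP.pos-* 2 Q))) ⟩
    + (2 * Q * s)       ≤⟨ ℤ.+≤+ (ℕP.≤-trans (ℕP.≤-reflexive (swap Q s)) (ℕP.*-monoʳ-≤ Q 2s≤d)) ⟩
    + (Q * d)           ≡⟨ ℤP.pos-* Q d ⟩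
    + Q ℤ.* + d         ∎)))
  where
  open ℤP.≤-Reasoning
  swap : ∀ Q s → 2 * Q * s ≡ Q * (2 * s)
  swap = solve-∀

0≤1-p : ∀ {p} → p ℚ.≤ 1ℚ → 0ℚ ℚ.≤ 1ℚ ℚ.- p
0≤1-p {p} p≤1 = subst (ℚ._≤ 1ℚ ℚ.- p) (ℚP.+-inverseʳ p) (ℚP.+-monoˡ-≤ (ℚ.- p) p≤1)

-- With a = 4x/(n+1)² ∈ [0, 1] and
-- g = n²(n+1)y/(n²(n-1) + y) we have g ≤ x + x' (the neighbourhood bound) and
-- a·z ≤ y' (the far-point bound), so f = a(x + x' + z) + (1 - a)g - x ≤ x' + y'.
f≤x′+y′ : ∀ n {x y x′ y′ z} → 2 ≤ n →
  4 * (x * z) ≤ y′ * (suc n * suc n) → x + x′ + z ≡ suc (n ^ 3) →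
  n ^ 2 * (n + 1) * y ≤ (x + x′) * (n ^ 2 * (n ∸ 1) + y) →
  4 * x ≤ (n + 1) ^ 2 → fFun n x y ℚ.≤ ℕ→ℚ (x′ + y′)
f≤x′+y′ n@(suc (suc k)) {x} {y} {x′} {y′} {z} (s≤s (s≤s z≤n)) far-bound partition nbr-bound 4x≤D₁ = begin
  a ℚ.* ℕ→ℚ (n ^ 3 + 1) ℚ.+ (1ℚ ℚ.- a) ℚ.* g ℚ.- X
    ≡⟨ cong (λ t → a ℚ.* t ℚ.+ (1ℚ ℚ.- a) ℚ.* g ℚ.- X) points ⟩
  a ℚ.* (X ℚ.+ X′ ℚ.+ Z) ℚ.+ (1ℚ ℚ.- a) ℚ.* g ℚ.- X
    ≤⟨ ℚP.+-monoˡ-≤ (ℚ.- X) (ℚP.+-monoʳ-≤ (a ℚ.* (X ℚ.+ X′ ℚ.+ Z))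
         (ℚP.*-monoˡ-≤-nonNeg (1ℚ ℚ.- a) {{ℚ.nonNegative (0≤1-p a≤1)}} g≤x+x′)) ⟩
  a ℚ.* (X ℚ.+ X′ ℚ.+ Z) ℚ.+ (1ℚ ℚ.- a) ℚ.* (X ℚ.+ X′) ℚ.- X
    ≡⟨ regroup a X X′ Z ⟩
  a ℚ.* Z ℚ.+ X′
    ≤⟨ ℚP.+-monoˡ-≤ X′ az≤y′ ⟩
  Y′ ℚ.+ X′
    ≡⟨ trans (ℚP.+-comm Y′ X′) (sym (ℕ→ℚ-+ x′ y′)) ⟩
  ℕ→ℚ (x′ + y′) ∎
  where
  open ℚP.≤-Reasoning
  open +-*-Solver
  D₁ = (n + 1) ^ 2
  D₂ = n ^ 2 * (n ∸ 1) + y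
  X = ℕ→ℚ x
  X′ = ℕ→ℚ x′
  Y′ = ℕ→ℚ y′
  Z = ℕ→ℚ z
  a = ℕ→ℚ (4 * x) ÷ℕ D₁
  g = ℕ→ℚ (n ^ 2 * (n + 1) * y) ÷ℕ D₂

  points : ℕ→ℚ (n ^ 3 + 1) ≡ X ℚ.+ X′ ℚ.+ Z
  points = trans (cong ℕ→ℚ (trans (ℕP.+-comm (n ^ 3) 1) (sym partition)))
                 (trans (ℕ→ℚ-+ (x + x′) z) (cong (ℚ._+ Z) (ℕ→ℚ-+ x x′)))

  a≤1 : a ℚ.≤ 1ℚ
  a≤1 = ÷ℕ-≤ D₁ (s≤s z≤n) (subst (ℕ→ℚ (4 * x) ℚ.≤_) (sym (ℚP.*-identityˡ (ℕ→ℚ D₁))) (ℕ→ℚ-mono-≤ 4x≤D₁))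

  g≤x+x′ : g ℚ.≤ X ℚ.+ X′
  g≤x+x′ = ÷ℕ-≤ D₂ (s≤s z≤n) (subst₂ ℚ._≤_ refl (trans (ℕ→ℚ-* (x + x′) D₂) (cong (ℚ._* ℕ→ℚ D₂) (ℕ→ℚ-+ x x′)))
                                     (ℕ→ℚ-mono-≤ nbr-bound))

  az≤y′ : a ℚ.* Z ℚ.≤ Y′
  az≤y′ = subst (ℚ._≤ Y′) (sym (trans (÷ℕ-*ʳ (ℕ→ℚ (4 * x)) Z D₁) (cong (_÷ℕ D₁) (sym (ℕ→ℚ-* (4 * x) z)))))
            (÷ℕ-≤ D₁ (s≤s z≤n) (subst₂ ℚ._≤_ (cong ℕ→ℚ (sym (ℕP.*-assoc 4 x z)))
                                           (trans (cong (λ t → ℕ→ℚ (y′ * t)) (sym (square-succ n))) (ℕ→ℚ-* y′ D₁))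
                                           (ℕ→ℚ-mono-≤ far-bound)))

  regroup : ∀ a X X′ Z → a ℚ.* (X ℚ.+ X′ ℚ.+ Z) ℚ.+ (1ℚ ℚ.- a) ℚ.* (X ℚ.+ X′) ℚ.- X ≡ a ℚ.* Z ℚ.+ X′
  regroup = solve 4 (λ a X X′ Z → a :* (X :+ X′ :+ Z) :+ (con 1ℚ :- a) :* (X :+ X′) :- X := a :* Z :+ X′) refl

-- Second case, (n+1)² < 4x: with b = (n+1)²/(4x) the far-point bound reads z ≤ b·y',
-- so n³ + 1 = x + x' + z ≤ (x - (1 - b)y') + x' + y'.  If x - (1 - b)y' < k + 1, then
-- n³ + 1 - k < 1 + x' + y'.
N-k≤x′+y′ : ∀ n {x x′ y′ z} (k : ℤ) → 0 < 4 * x →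
  4 * (x * z) ≤ y′ * (suc n * suc n) → x + x′ + z ≡ suc (n ^ 3) →
  ℕ→ℚ x ℚ.- (1ℚ ℚ.- ℕ→ℚ ((n + 1) ^ 2) ÷ℕ (4 * x)) ℚ.* ℕ→ℚ y′ ℚ.< ℤ→ℚ (k ℤ.+ + 1) →
  + (n ^ 3 + 1) ℤ.- k ℤ.≤ + (x′ + y′)
N-k≤x′+y′ n {x} {x′} {y′} {z} k 0<4x far-bound partition hyp =
  <-suc⇒≤ (ℤ→ℚ-cancel-< (subst₂ ℚ._<_ lhs rhs (ℚP.+-monoˡ-< (ℚ.- K) N<)))
  where
  open ℚP.≤-Reasoning
  open +-*-Solver
  D₁ = (n + 1) ^ 2
  X = ℕ→ℚ x
  X′ = ℕ→ℚ x′
  Y′ = ℕ→ℚ y′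
  K = ℤ→ℚ k
  b = ℕ→ℚ D₁ ÷ℕ (4 * x)

  <-suc⇒≤ : ∀ {i q} → i ℤ.< + suc q → i ℤ.≤ + q
  <-suc⇒≤ {+ _}        (ℤ.+<+ (s≤s i≤q)) = ℤ.+≤+ i≤q
  <-suc⇒≤ {ℤ.-[1+ _ ]} _                 = ℤ.-≤+

  z≤by′ : ℕ→ℚ z ℚ.≤ b ℚ.* Y′
  z≤by′ = subst (ℕ→ℚ z ℚ.≤_) (sym (÷ℕ-*ʳ (ℕ→ℚ D₁) Y′ (4 * x)))
            (≤-÷ℕ (4 * x) 0<4x (subst₂ ℚ._≤_ (ℕ→ℚ-* z (4 * x)) (ℕ→ℚ-* D₁ y′)
              (ℕ→ℚ-mono-≤ (subst₂ _≤_ (commute x z) (trans (ℕP.*-comm y′ _) (cong (_* y′) (sym (square-succ n))))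
                                       far-bound))))
    where
    commute : ∀ x z → 4 * (x * z) ≡ z * (4 * x)
    commute = solve-∀

  N< : ℕ→ℚ (n ^ 3 + 1) ℚ.< (K ℚ.+ 1ℚ) ℚ.+ (X′ ℚ.+ Y′)
  N< = begin-strict
    ℕ→ℚ (n ^ 3 + 1)
      ≡⟨ cong ℕ→ℚ (trans (ℕP.+-comm (n ^ 3) 1) (sym partition)) ⟩
    ℕ→ℚ (x + x′ + z)
      ≡⟨ trans (ℕ→ℚ-+ (x + x′) z) (cong (ℚ._+ ℕ→ℚ z) (ℕ→ℚ-+ x x′)) ⟩
    X ℚ.+ X′ ℚ.+ ℕ→ℚ z
      ≤⟨ ℚP.+-monoʳ-≤ (X ℚ.+ X′) z≤by′ ⟩
    X ℚ.+ X′ ℚ.+ b ℚ.* Y′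
      ≡⟨ regroup X X′ Y′ b ⟩
    (X ℚ.- (1ℚ ℚ.- b) ℚ.* Y′) ℚ.+ (X′ ℚ.+ Y′)
      <⟨ ℚP.+-monoˡ-< (X′ ℚ.+ Y′) (subst (_ ℚ.<_) (ℤ→ℚ-+ k (+ 1)) hyp) ⟩
    (K ℚ.+ 1ℚ) ℚ.+ (X′ ℚ.+ Y′) ∎
    where
    regroup : ∀ X X′ Y′ b → X ℚ.+ X′ ℚ.+ b ℚ.* Y′ ≡ (X ℚ.- (1ℚ ℚ.- b) ℚ.* Y′) ℚ.+ (X′ ℚ.+ Y′)
    regroup = solve 4 (λ X X′ Y′ b → X :+ X′ :+ b :* Y′ := (X :- (con 1ℚ :- b) :* Y′) :+ (X′ :+ Y′)) refl

  lhs : ℕ→ℚ (n ^ 3 + 1) ℚ.- K ≡ ℤ→ℚ (+ (n ^ 3 + 1) ℤ.- k)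
  lhs = sym (trans (ℤ→ℚ-+ (+ (n ^ 3 + 1)) (ℤ.- k)) (cong (ℕ→ℚ (n ^ 3 + 1) ℚ.+_) (ℤ→ℚ-neg k)))

  rhs : (K ℚ.+ 1ℚ) ℚ.+ (X′ ℚ.+ Y′) ℚ.- K ≡ ℤ→ℚ (+ suc (x′ + y′))
  rhs = trans (cancel K (X′ ℚ.+ Y′)) (sym (trans (ℤ→ℚ-+ (+ 1) (+ (x′ + y′))) (cong (1ℚ ℚ.+_) (ℕ→ℚ-+ x′ y′))))
    where
    cancel : ∀ K Q → (K ℚ.+ 1ℚ) ℚ.+ Q ℚ.- K ≡ 1ℚ ℚ.+ Q
    cancel = solve 2 (λ K Q → (K :+ con 1ℚ) :+ Q :- K := con 1ℚ :+ Q) refl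

first-case : ∀ n (k : ℤ) x y x′ y′ z → 2 ≤ n →
  4 * (x * z) ≤ y′ * (suc n * suc n) → x + x′ + z ≡ suc (n ^ 3) →
  n ^ 2 * (n + 1) * y ≤ (x + x′) * (n ^ 2 * (n ∸ 1) + y) →
  ℕ→ℚ x ℚ.≤ ℕ→ℚ ((n + 1) ^ 2) ÷ℕ 4 →
  ℤ→ℚ (+ 2 ℤ.* (+ (n ^ 3 + 1) ℤ.- k)) ÷ℕ (n ^ 4 + n ^ 2) ℚ.≤ fFun n x y ÷ℕ (x + y) →
  ℤ→ℚ (+ 2 ℤ.* (+ (n ^ 3 + 1) ℤ.- k)) ÷ℕ (n ^ 2 * (n ^ 2 + 1)) ℚ.≤ ℕ→ℚ (x′ + y′) ÷ℕ (x + y)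
first-case n k x y x′ y′ z 2≤n far-bound partition nbr-bound x≤D₁/4 hyp =
  ℚP.≤-trans (subst (λ d → ℤ→ℚ (+ 2 ℤ.* (+ (n ^ 3 + 1) ℤ.- k)) ÷ℕ d ℚ.≤ fFun n x y ÷ℕ (x + y)) (factor n) hyp)
             (÷ℕ-mono-≤ (x + y) (f≤x′+y′ n {x} {y} {x′} {y′} {z} 2≤n far-bound partition nbr-bound 4x≤D₁))
  where
  factor : ∀ n → n * (n * (n * (n * 1))) + n * (n * 1) ≡ n * (n * 1) * (n * (n * 1) + 1)
  factor = solve-∀
  4x≤D₁ : 4 * x ≤ (n + 1) ^ 2
  4x≤D₁ = subst (_≤ (n + 1) ^ 2) (ℕP.*-comm x 4)
    (ℕ→ℚ-cancel-≤ (subst (ℚ._≤ ℕ→ℚ ((n + 1) ^ 2)) (sym (ℕ→ℚ-* x 4)) (≤-÷ℕ⁻¹ 4 (s≤s z≤n) x≤D₁/4)))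

second-case : ∀ n (k : ℤ) x y x′ y′ z →
  4 * (x * z) ≤ y′ * (suc n * suc n) → x + x′ + z ≡ suc (n ^ 3) →
  1 ≤ x + y → 2 * (x + y) ≤ n ^ 2 * (n ^ 2 + 1) →
  ℕ→ℚ ((n + 1) ^ 2) ÷ℕ 4 ℚ.< ℕ→ℚ x →
  ℕ→ℚ x ℚ.- (1ℚ ℚ.- ℕ→ℚ ((n + 1) ^ 2) ÷ℕ (4 * x)) ℚ.* ℕ→ℚ y′ ℚ.< ℤ→ℚ (k ℤ.+ + 1) →
  ℤ→ℚ (+ 2 ℤ.* (+ (n ^ 3 + 1) ℤ.- k)) ÷ℕ (n ^ 2 * (n ^ 2 + 1)) ℚ.≤ ℕ→ℚ (x′ + y′) ÷ℕ (x + y)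
second-case n k x y x′ y′ z far-bound partition 1≤s 2s≤d D₁/4<x hyp =
  2T/d≤Q/s 0<d 1≤s (N-k≤x′+y′ n {x} {x′} {y′} {z} k 0<4x far-bound partition hyp) 2s≤d
  where
  0<d : 0 < n ^ 2 * (n ^ 2 + 1)
  0<d = ℕP.≤-trans 1≤s (ℕP.≤-trans (ℕP.m≤m+n (x + y) _) 2s≤d)
  0<4x : 0 < 4 * x
  0<4x = ℕP.≤-<-trans z≤n (subst ((n + 1) ^ 2 <_) (ℕP.*-comm x 4)
           (ℕ→ℚ-cancel-< (subst (ℕ→ℚ ((n + 1) ^ 2) ℚ.<_) (sym (ℕ→ℚ-* x 4)) (÷ℕ-<⁻¹ 4 (s≤s z≤n) D₁/4<x))))

-- Lemma 3.1.
lemma3p1 : (n : ℕ) → 2 ℕ.≤ n → (U : Unital n) →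
    (X : Subset (ℕ.suc (n ^ 3))) → (Y : Subset (Unital.nLines U)) →
    1 ℕ.≤ ∣ X ∣ ℕ.+ ∣ Y ∣ →
    2 ℕ.* (∣ X ∣ ℕ.+ ∣ Y ∣) ℕ.≤ (n ^ 3 ℕ.+ 1) ℕ.+ Unital.nLines U →
    (k : ℤ) → IsFloorC n k →
    ((ℕ→ℚ ∣ X ∣ ℚ.≤ ℕ→ℚ ((n ℕ.+ 1) ^ 2) ÷ℕ 4) ×
       (ℤ→ℚ (+ 2 ℤ.* (+ (n ^ 3 ℕ.+ 1) ℤ.- k)) ÷ℕ (n ^ 4 ℕ.+ n ^ 2)
         ℚ.≤ fFun n ∣ X ∣ ∣ Y ∣ ÷ℕ (∣ X ∣ ℕ.+ ∣ Y ∣))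
     ⊎
     ((ℕ→ℚ ((n ℕ.+ 1) ^ 2) ÷ℕ 4 ℚ.< ℕ→ℚ ∣ X ∣) ×
       (ℕ→ℚ ∣ X ∣ ℚ.- (ℚ.1ℚ ℚ.- ℕ→ℚ ((n ℕ.+ 1) ^ 2) ÷ℕ (4 ℕ.* ∣ X ∣)) ℚ.* ℕ→ℚ (y′ U X Y)
         ℚ.< ℤ→ℚ (k ℤ.+ + 1)))) →
    ℤ→ℚ (+ 2 ℤ.* (+ (n ^ 3 ℕ.+ 1) ℤ.- k)) ÷ℕ (n ^ 2 ℕ.* (n ^ 2 ℕ.+ 1))
      ℚ.≤ ℕ→ℚ (x′ U X Y ℕ.+ y′ U X Y) ÷ℕ (∣ X ∣ ℕ.+ ∣ Y ∣)
lemma3p1 n 2≤n U X Y 1≤s 2s≤V k _ =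
  [ uncurry (first-case n k ∣ X ∣ ∣ Y ∣ (x′ U X Y) (y′ U X Y) #far 2≤n far-bound partition nbr-bound)
  , uncurry (second-case n k ∣ X ∣ ∣ Y ∣ (x′ U X Y) (y′ U X Y) #far far-bound partition 1≤s
                       (half-vertices 1≤n (∣ X ∣ + ∣ Y ∣) 2s≤V)) ]′
  where
  1≤n : 1 ≤ n
  1≤n = ℕP.≤-trans (s≤s z≤n) 2≤n
  open Design U using (half-vertices)
  open Neighbourhood U
  open FarPoints X Y using (#far; far-bound; partition)
  open LinesOfY 1≤n Y using (neighbourhood-bound; #NY≤)
  nbr-bound : n ^ 2 * (n + 1) * ∣ Y ∣ ≤ (∣ X ∣ + x′ U X Y) * (n ^ 2 * (n ∸ 1) + ∣ Y ∣)
  nbr-bound = ℕP.≤-trans neighbourhood-bound (ℕP.*-monoˡ-≤ (n ^ 2 * (n ∸ 1) + ∣ Y ∣) (#NY≤ X))
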